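{- Let $T$ be a tree. Then there exists an ISTDF $f$ of $T$ of weight $\gamma^{0}_{st}(T)$ such that, for every support vertex $v_i$ of $T$, $f$ assigns the value $1$ to at least $\lfloor \ell_i/2 \rfloor$ of the leaves adjacent to $v_i$, where $\ell_i$ is the number of leaves adjacent to $v_i$.
   Context: A leaf is a vertex of degree $1$; a support vertex is a vertex adjacent to a leaf. For a vertex $v$, $N(v)$ denotes its open neighborhood. For $f: V(T) \to \mathbb{R}$ and $B \subseteq V(T)$ write $f(B) = \sum_{v \in B} f(v)$; $f(V(T))$ is the weight of $f$. An inverse signed total dominating function (ISTDF) of $T$ is a function $f: V(T) \to \{ -1,1\}$ with $f(N(v)) \leq 0$ for every vertex $v$. The inverse signed total domination number $\gamma^{0}_{st}(T)$ is the maximum weight of an ISTDF of $T$. -}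

module Defs where

open import Data.Nat using (ℕ; zero; suc; _≤_)
open import Data.Integer as ℤ using (ℤ; 0ℤ; 1ℤ; -1ℤ)
open import Data.Fin using (Fin; zero; suc)
open import Data.Bool using (Bool; true; false; if_then_else_; _∧_)
open import Data.List using (List; []; _∷_; _++_; [_]; length)
open import Data.List.Relation.Unary.Unique.Propositional using (Unique)
open import Data.List.Relation.Unary.Linked using (Linked)
open import Data.Product using (Σ; _×_; ∃; ∃-syntax)
open import Data.Sum using (_⊎_)
open import Relation.Binary.PropositionalEquality using (_≡_)
open import Relation.Nullary using (¬_)

record Graph (n : ℕ) : Set where
  field
    adj    : Fin n → Fin n → Bool
    sym    : ∀ u v → adj u v ≡ adj v u
    irrefl : ∀ v → adj v v ≡ false
open Graph public

sumℤ : ∀ {n} → (Fin n → ℤ) → ℤ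
sumℤ {zero}  f = 0ℤ
sumℤ {suc n} f = f zero ℤ.+ sumℤ (λ i → f (suc i))

count : ∀ {n} → (Fin n → Bool) → ℕ
count {zero}  p = 0
count {suc n} p = (if p zero then 1 else 0) Data.Nat.+ count (λ i → p (suc i))

Edge : ∀ {n} → Graph n → Fin n → Fin n → Set
Edge G u v = adj G u v ≡ true

data Walk {n} (G : Graph n) : Fin n → Fin n → Set where
  here : ∀ {v} → Walk G v v
  step : ∀ {u w v} → Edge G u w → Walk G w v → Walk G u v

Connected : ∀ {n} → Graph n → Set
Connected G = ∀ u v → Walk G u v

-- A cycle: distinct vertices x, x₁, …, x_k (k ≥ 2, i.e. at least 3 vertices),
-- consecutive ones adjacent and x_k adjacent to x.
IsCycle : ∀ {n} → Graph n → Fin n → List (Fin n) → Set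
IsCycle G x xs = (2 ≤ length xs) × Unique (x ∷ xs) × Linked (Edge G) (x ∷ xs ++ [ x ])

Acyclic : ∀ {n} → Graph n → Set
Acyclic G = ∀ x xs → ¬ IsCycle G x xs

IsTree : ∀ {n} → Graph n → Set
IsTree {n} G = (1 ≤ n) × Connected G × Acyclic G

degree : ∀ {n} → Graph n → Fin n → ℕ
degree G v = count (adj G v)

IsLeaf : ∀ {n} → Graph n → Fin n → Set
IsLeaf G v = degree G v ≡ 1

isLeafᵇ : ∀ {n} → Graph n → Fin n → Bool
isLeafᵇ G v with degree G v
... | 1 = true
... | _ = false

IsSupport : ∀ {n} → Graph n → Fin n → Set
IsSupport G v = ∃[ u ] (Edge G v u × IsLeaf G u)

leafCount : ∀ {n} → Graph n → Fin n → ℕ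
leafCount G v = count (λ u → adj G v u ∧ isLeafᵇ G u)

nbhdSum : ∀ {n} → Graph n → (Fin n → ℤ) → Fin n → ℤ
nbhdSum G f v = sumℤ (λ u → if adj G v u then f u else 0ℤ)

weight : ∀ {n} → (Fin n → ℤ) → ℤ
weight f = sumℤ f

IsISTDF : ∀ {n} → Graph n → (Fin n → ℤ) → Set
IsISTDF G f = (∀ v → (f v ≡ 1ℤ) ⊎ (f v ≡ -1ℤ)) × (∀ v → nbhdSum G f v ℤ.≤ 0ℤ)

-- f attains γ⁰_st(G), the maximum weight of an ISTDF.
IsMaxISTDF : ∀ {n} → Graph n → (Fin n → ℤ) → Set
IsMaxISTDF G f = IsISTDF G f × (∀ g → IsISTDF G g → weight g ℤ.≤ weight f)

isOneᵇ : ℤ → Bool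
isOneᵇ (ℤ.+ 1) = true
isOneᵇ _ = false

posLeafCount : ∀ {n} → Graph n → (Fin n → ℤ) → Fin n → ℕ
posLeafCount G f v = count (λ u → adj G v u ∧ isLeafᵇ G u ∧ isOneᵇ (f u))

module Submission where

-- Call an ISTDF f optimal if it has maximum weight and, among maximum-weight
-- ISTDFs, labels the most leaves with 1; optimal ISTDFs exist since the finitely
-- many ±1-functions can be enumerated.  Fix v, let p (q) count the leaf
-- neighbours of v labelled 1 (−1), and suppose q ≥ p + 2.  A leaf neighbour u
-- with f(u) = −1 lies only in N(v).  If v has a positive neighbour w that is not
-- a leaf, swapping the labels of u and w keeps f an ISTDF of the same weight
-- with one more positive leaf; otherwise f(N(v)) ≤ p − q ≤ −2, and raising f(u)
-- to 1 yields a heavier ISTDF.  So q ≤ p + 1, whence ⌊ℓ(v)/2⌋ = ⌊(p+q)/2⌋ ≤ p.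
-- The argument works in every graph.

open import Defs hiding (sym)
open import Data.Nat as ℕ using (ℕ; zero; suc; _≤_; _/_; z≤n; s≤s)
import Data.Nat.Properties as ℕP
import Data.Nat.Solver
open import Data.Nat.DivMod using (m/n*n≤m)
open import Data.Fin using (Fin; zero; suc; _≟_)
open import Data.Fin.Properties using (all?; any?; suc-injective)
open import Data.Integer as ℤ using (ℤ; +_; 0ℤ; 1ℤ; -1ℤ; -[1+_]; +≤+; -≤+)
import Data.Integer.Properties as ℤP
open import Data.Integer.Solver using (module +-*-Solver)
open import Algebra.Properties.CommutativeSemigroup ℤP.+-commutativeSemigroup
  using (xy∙z≈xz∙y; interchange)
open import Data.Bool as Bool using (Bool; true; false; if_then_else_; _∧_; not)
open import Data.Bool.Properties using (∧-assoc)
open import Data.Product using (Σ; _×_; _,_; proj₁; proj₂; ∃)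
open import Data.Sum using (_⊎_; inj₁; inj₂)
open import Data.Empty using (⊥; ⊥-elim)
open import Data.List using (List; []; _∷_; map; _++_; filter)
open import Data.List.Membership.Propositional using (_∈_)
open import Data.List.Membership.Propositional.Properties
  using (∈-map⁺; ∈-++⁺ˡ; ∈-++⁺ʳ; ∈-filter⁺)
open import Data.List.Relation.Unary.Any using (here)
open import Data.List.Relation.Unary.All using (lookup)
open import Data.List.Relation.Unary.All.Properties using (all-filter)
import Data.Vec.Functional as Vector
open import Data.Vec.Functional.Properties using (updateAt-updates; updateAt-minimal)
open import Function using (_∘_; const)
open import Relation.Nullary using (Dec; yes; no)
open import Relation.Nullary.Decidable using (_×-dec_; _⊎-dec_)
open import Relation.Unary using (Decidable)
open import Relation.Binary.PropositionalEquality

open import Data.List.Extrema ℤP.≤-totalOrder using (argmax; argmax-all; f[xs]≤f[argmax])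

sumℤ-cong : ∀ {n} {h h' : Fin n → ℤ} → h ≗ h' → sumℤ h ≡ sumℤ h'
sumℤ-cong {zero}  e = refl
sumℤ-cong {suc n} e = cong₂ ℤ._+_ (e zero) (sumℤ-cong (e ∘ suc))

sumℤ-nonpos : ∀ {n} (h : Fin n → ℤ) → (∀ x → h x ℤ.≤ 0ℤ) → sumℤ h ℤ.≤ 0ℤ
sumℤ-nonpos {zero}  h le = ℤP.≤-refl
sumℤ-nonpos {suc n} h le = ℤP.+-mono-≤ (le zero) (sumℤ-nonpos (h ∘ suc) (le ∘ suc))

sumℤ-update : ∀ {n} (h h' : Fin n → ℤ) (u : Fin n) (d : ℤ) →
  (∀ x → x ≢ u → h' x ≡ h x) → h' u ≡ h u ℤ.+ d → sumℤ h' ≡ sumℤ h ℤ.+ d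
sumℤ-update {suc n} h h' zero d off at = begin
    h' zero ℤ.+ sumℤ (h' ∘ suc)
  ≡⟨ cong₂ ℤ._+_ at (sumℤ-cong (λ i → off (suc i) λ ())) ⟩
    (h zero ℤ.+ d) ℤ.+ sumℤ (h ∘ suc)
  ≡⟨ xy∙z≈xz∙y (h zero) d (sumℤ (h ∘ suc)) ⟩
    (h zero ℤ.+ sumℤ (h ∘ suc)) ℤ.+ d ∎
  where open ≡-Reasoning
sumℤ-update {suc n} h h' (suc u) d off at = begin
    h' zero ℤ.+ sumℤ (h' ∘ suc)
  ≡⟨ cong₂ ℤ._+_ (off zero λ ()) (sumℤ-update (h ∘ suc) (h' ∘ suc) u d (λ x x≢u → off (suc x) (x≢u ∘ suc-injective)) at) ⟩
    h zero ℤ.+ (sumℤ (h ∘ suc) ℤ.+ d)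
  ≡⟨ sym (ℤP.+-assoc (h zero) _ d) ⟩
    (h zero ℤ.+ sumℤ (h ∘ suc)) ℤ.+ d ∎
  where open ≡-Reasoning

indicator : Bool → ℕ
indicator b = if b then 1 else 0

count-cong : ∀ {n} {p p' : Fin n → Bool} → p ≗ p' → count p ≡ count p'
count-cong {zero}  e = refl
count-cong {suc n} e = cong₂ ℕ._+_ (cong indicator (e zero)) (count-cong (e ∘ suc))

count-update : ∀ {n} (p p' : Fin n → Bool) (u : Fin n) →
  (∀ x → x ≢ u → p' x ≡ p x) → p' u ≡ true → p u ≡ false → count p' ≡ suc (count p)
count-update {suc n} p p' zero off t f rewrite t | f =
  cong suc (count-cong (λ i → off (suc i) λ ()))
count-update {suc n} p p' (suc u) off t f rewrite off zero (λ ()) =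
  trans (cong (indicator (p zero) ℕ.+_)
              (count-update (p ∘ suc) (p' ∘ suc) u (λ x x≢u → off (suc x) (x≢u ∘ suc-injective)) t f))
        (ℕP.+-suc (indicator (p zero)) _)

count-split : ∀ {n} (c d : Fin n → Bool) →
  count c ≡ count (λ x → c x ∧ d x) ℕ.+ count (λ x → c x ∧ not (d x))
count-split {zero}  c d = refl
count-split {suc n} c d with c zero | d zero
... | false | _     = count-split (c ∘ suc) (d ∘ suc)
... | true  | true  = cong suc (count-split (c ∘ suc) (d ∘ suc))
... | true  | false = trans (cong suc (count-split (c ∘ suc) (d ∘ suc))) (sym (ℕP.+-suc _ _))

count-mono : ∀ {n} {p q : Fin n → Bool} → (∀ x → p x ≡ true → q x ≡ true) → count p ≤ count q
count-mono {zero} p⇒q = z≤n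
count-mono {suc n} {p} {q} p⇒q with p zero in p0 | q zero in q0
... | false | false = count-mono (p⇒q ∘ suc)
... | false | true  = ℕP.m≤n⇒m≤1+n (count-mono (p⇒q ∘ suc))
... | true  | true  = s≤s (count-mono (p⇒q ∘ suc))
... | true  | false with trans (sym q0) (p⇒q zero p0)
...   | ()

count-witness : ∀ {n} (p : Fin n → Bool) → 1 ≤ count p → ∃ λ x → p x ≡ true
count-witness {suc n} p pos with p zero in p0
... | true  = zero , p0
... | false with count-witness (p ∘ suc) pos
...   | x , px = suc x , px

count-≥1 : ∀ {n} (p : Fin n → Bool) {x} → p x ≡ true → 1 ≤ count p
count-≥1 p {zero} px rewrite px = s≤s z≤n
count-≥1 {suc n} p {suc x} px =
  ℕP.≤-trans (count-≥1 (p ∘ suc) px) (ℕP.m≤n+m _ (indicator (p zero)))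

count-≥2 : ∀ {n} (p : Fin n → Bool) {x y} → x ≢ y → p x ≡ true → p y ≡ true → 2 ≤ count p
count-≥2 p {zero}  {zero}  x≢y _ _ = ⊥-elim (x≢y refl)
count-≥2 p {zero}  {suc y} _ px py rewrite px = s≤s (count-≥1 (p ∘ suc) py)
count-≥2 p {suc x} {zero}  _ px py rewrite py = s≤s (count-≥1 (p ∘ suc) px)
count-≥2 p {suc x} {suc y} x≢y px py =
  ℕP.≤-trans (count-≥2 (p ∘ suc) (x≢y ∘ cong suc) px py) (ℕP.m≤n+m _ (indicator (p zero)))

Sign : ℤ → Set
Sign z = (z ≡ 1ℤ) ⊎ (z ≡ -1ℤ)

sign? : (z : ℤ) → Dec (Sign z)
sign? z = (z ℤ.≟ 1ℤ) ⊎-dec (z ℤ.≟ -1ℤ)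

sign-one : ∀ {z} → Sign z → isOneᵇ z ≡ true → z ≡ 1ℤ
sign-one (inj₁ z≡1) _ = z≡1
sign-one (inj₂ refl) ()

sign-minus : ∀ {z} → Sign z → isOneᵇ z ≡ false → z ≡ -1ℤ
sign-minus (inj₁ refl) ()
sign-minus (inj₂ z≡-1) _ = z≡-1

selectedSum : ∀ {n} (a : Fin n → Bool) (f : Fin n → ℤ) → (∀ x → Sign (f x)) →
  sumℤ (λ x → if a x then f x else 0ℤ) ℤ.+ + count (λ x → a x ∧ not (isOneᵇ (f x)))
    ≡ + count (λ x → a x ∧ isOneᵇ (f x))
selectedSum {zero}  a f sf = refl
selectedSum {suc n} a f sf = begin
    (t ℤ.+ S) ℤ.+ + (indicator (a zero ∧ not (o zero)) ℕ.+ N)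
  ≡⟨ cong (λ z → (t ℤ.+ S) ℤ.+ z) (ℤP.pos-+ (indicator (a zero ∧ not (o zero))) N) ⟩
    (t ℤ.+ S) ℤ.+ (+ indicator (a zero ∧ not (o zero)) ℤ.+ + N)
  ≡⟨ interchange t S _ (+ N) ⟩
    (t ℤ.+ + indicator (a zero ∧ not (o zero))) ℤ.+ (S ℤ.+ + N)
  ≡⟨ cong₂ ℤ._+_ head-term (selectedSum (a ∘ suc) (f ∘ suc) (sf ∘ suc)) ⟩
    + indicator (a zero ∧ o zero) ℤ.+ + P
  ≡⟨ sym (ℤP.pos-+ (indicator (a zero ∧ o zero)) P) ⟩
    + (indicator (a zero ∧ o zero) ℕ.+ P) ∎
  where
    open ≡-Reasoning
    o : Fin (suc n) → Bool
    o x = isOneᵇ (f x)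
    t S : ℤ
    t = if a zero then f zero else 0ℤ
    S = sumℤ (λ x → if a (suc x) then f (suc x) else 0ℤ)
    N P : ℕ
    N = count (λ x → a (suc x) ∧ not (o (suc x)))
    P = count (λ x → a (suc x) ∧ o (suc x))
    head-term : t ℤ.+ + indicator (a zero ∧ not (o zero)) ≡ + indicator (a zero ∧ o zero)
    head-term with a zero | sf zero
    ... | false | _        = refl
    ... | true  | inj₁ f≡1 rewrite f≡1 = refl
    ... | true  | inj₂ f≡-1 rewrite f≡-1 = refl

relabel : ∀ {n} → (Fin n → ℤ) → Fin n → ℤ → Fin n → ℤ
relabel f u c = Vector.updateAt f u (const c)

relabel-at : ∀ {n} (f : Fin n → ℤ) u c → relabel f u c u ≡ c
relabel-at f u c = updateAt-updates u f

relabel-off : ∀ {n} (f : Fin n → ℤ) u c {x} → x ≢ u → relabel f u c x ≡ f x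
relabel-off f u c {x} = updateAt-minimal x u f

relabel-sign : ∀ {n} (f : Fin n → ℤ) u {c} → Sign c → (∀ x → Sign (f x)) →
  ∀ x → Sign (relabel f u c x)
relabel-sign f u {c} sc sf x with x ≟ u
... | yes refl = subst Sign (sym (relabel-at f u c)) sc
... | no x≢u   = subst Sign (sym (relabel-off f u c x≢u)) (sf x)

-- The value at u grows by c − f(u); this is the change of every sum counting u once.
relabel-increment : ∀ {n} (f : Fin n → ℤ) u c → relabel f u c u ≡ f u ℤ.+ (c ℤ.- f u)
relabel-increment f u c = trans (relabel-at f u c) (solve 2 (λ c a → c := a :+ (c :- a)) refl c (f u))
  where open +-*-Solver using (solve; _:=_; _:+_; _:-_)

weight-relabel : ∀ {n} (f : Fin n → ℤ) u c → weight (relabel f u c) ≡ weight f ℤ.+ (c ℤ.- f u)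
weight-relabel f u c = sumℤ-update f (relabel f u c) u _ (λ x → relabel-off f u c) (relabel-increment f u c)

nbhdSum-relabel : ∀ {n} (G : Graph n) (f : Fin n → ℤ) u c x →
  nbhdSum G (relabel f u c) x ≡ nbhdSum G f x ℤ.+ (if adj G x u then c ℤ.- f u else 0ℤ)
nbhdSum-relabel G f u c x =
  sumℤ-update _ _ u _ (λ y y≢u → cong (λ z → if adj G x y then z else 0ℤ) (relabel-off f u c y≢u)) at-u
  where
  at-u : (if adj G x u then relabel f u c u else 0ℤ)
       ≡ (if adj G x u then f u else 0ℤ) ℤ.+ (if adj G x u then c ℤ.- f u else 0ℤ)
  at-u with adj G x u
  ... | false = refl
  ... | true  = relabel-increment f u c

leafᵇ-degree : ∀ {n} (G : Graph n) u → isLeafᵇ G u ≡ true → degree G u ≡ 1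
leafᵇ-degree G u with degree G u
... | 0           = λ ()
... | 1           = λ _ → refl
... | suc (suc _) = λ ()

leaf-unique-neighbour : ∀ {n} (G : Graph n) {u x y} → isLeafᵇ G u ≡ true →
  adj G x u ≡ true → adj G y u ≡ true → x ≡ y
leaf-unique-neighbour G {u} {x} {y} u-leaf x~u y~u with x ≟ y
... | yes x≡y = x≡y
... | no  x≢y = ⊥-elim (ℕP.1+n≰n (subst (2 ≤_) (leafᵇ-degree G u u-leaf)
      (count-≥2 (adj G u) x≢y (trans (Graph.sym G u x) x~u) (trans (Graph.sym G u y) y~u))))

nbhdSum-cong : ∀ {n} (G : Graph n) {g h : Fin n → ℤ} → g ≗ h → ∀ v → nbhdSum G g v ≡ nbhdSum G h v
nbhdSum-cong G e v = sumℤ-cong (λ u → cong (λ z → if adj G v u then z else 0ℤ) (e u))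

ISTDF-ext : ∀ {n} (G : Graph n) {g h : Fin n → ℤ} → g ≗ h → IsISTDF G g → IsISTDF G h
ISTDF-ext G e (sg , ng) =
  (λ x → subst Sign (e x) (sg x)) , (λ v → subst (ℤ._≤ 0ℤ) (nbhdSum-cong G e v) (ng v))

isISTDF? : ∀ {n} (G : Graph n) → Decidable (IsISTDF G)
isISTDF? G f = all? (λ v → sign? (f v)) ×-dec all? (λ v → nbhdSum G f v ℤ.≤? 0ℤ)

minus-ISTDF : ∀ {n} (G : Graph n) → IsISTDF G (const -1ℤ)
minus-ISTDF G = (λ _ → inj₂ refl) , (λ v → sumℤ-nonpos _ (λ u → nonpos (adj G v u)))
  where
  nonpos : ∀ b → (if b then -1ℤ else 0ℤ) ℤ.≤ 0ℤ
  nonpos true  = -≤+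
  nonpos false = ℤP.≤-refl

positiveLeaves : ∀ {n} → Graph n → (Fin n → ℤ) → ℕ
positiveLeaves G h = count (λ x → isLeafᵇ G x ∧ isOneᵇ (h x))

Optimal : ∀ {n} → Graph n → (Fin n → ℤ) → Set
Optimal G f = IsMaxISTDF G f ×
  (∀ g → IsISTDF G g → weight g ≡ weight f → positiveLeaves G g ≤ positiveLeaves G f)

module LeafMove {n} (G : Graph n) (f : Fin n → ℤ) (isf : IsISTDF G f) {u v : Fin n}
  (u-leaf : isLeafᵇ G u ≡ true) (v~u : adj G v u ≡ true) (fu : f u ≡ -1ℤ) where

  only-v : ∀ {x} → adj G x u ≡ true → x ≡ v
  only-v x~u = leaf-unique-neighbour G u-leaf x~u v~u

  f-bound : ∀ x → nbhdSum G f x ℤ.+ 0ℤ ℤ.≤ 0ℤ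
  f-bound x = subst (ℤ._≤ 0ℤ) (sym (ℤP.+-identityʳ _)) (proj₂ isf x)

  -- (N + 2) − 2 = N: the two moves of a swap cancel at v.
  cancel-two : ∀ z → (z ℤ.+ + 2) ℤ.+ -[1+ 1 ] ≡ z
  cancel-two z = trans (ℤP.+-assoc z (+ 2) -[1+ 1 ]) (ℤP.+-identityʳ z)

  raised : Fin n → ℤ
  raised = relabel f u 1ℤ

  raised-nbhd : ∀ x → nbhdSum G raised x ≡ nbhdSum G f x ℤ.+ (if adj G x u then + 2 else 0ℤ)
  raised-nbhd x rewrite nbhdSum-relabel G f u 1ℤ x | fu = refl

  raised-weight : weight raised ≡ weight f ℤ.+ + 2
  raised-weight rewrite weight-relabel f u 1ℤ | fu = refl

  raised-sign : ∀ x → Sign (raised x)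
  raised-sign = relabel-sign f u (inj₁ refl) (proj₁ isf)

  raised-ISTDF : nbhdSum G f v ℤ.+ + 2 ℤ.≤ 0ℤ → IsISTDF G raised
  raised-ISTDF slack = raised-sign , bound
    where
    bound : ∀ x → nbhdSum G raised x ℤ.≤ 0ℤ
    bound x rewrite raised-nbhd x with adj G x u in x~u
    ... | true rewrite only-v x~u = slack
    ... | false = f-bound x

  module Swap {w : Fin n} (v~w : adj G v w ≡ true) (fw : f w ≡ 1ℤ) where

    w≢u : w ≢ u
    w≢u w≡u with trans (sym fw) (trans (cong f w≡u) fu)
    ... | ()

    raised-w : raised w ≡ 1ℤ
    raised-w = trans (relabel-off f u 1ℤ w≢u) fw

    swapped : Fin n → ℤ
    swapped = relabel raised w -1ℤ

    swapped-nbhd : ∀ x → nbhdSum G swapped x ≡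
      (nbhdSum G f x ℤ.+ (if adj G x u then + 2 else 0ℤ)) ℤ.+ (if adj G x w then -[1+ 1 ] else 0ℤ)
    swapped-nbhd x rewrite nbhdSum-relabel G raised w -1ℤ x | raised-w | raised-nbhd x = refl

    swapped-ISTDF : IsISTDF G swapped
    swapped-ISTDF = relabel-sign raised w (inj₂ refl) raised-sign , bound
      where
      bound : ∀ x → nbhdSum G swapped x ℤ.≤ 0ℤ
      bound x rewrite swapped-nbhd x with adj G x u in x~u
      ... | true rewrite only-v x~u | v~w =
        subst (ℤ._≤ 0ℤ) (sym (cancel-two (nbhdSum G f v))) (proj₂ isf v)
      ... | false with adj G x w
      ...   | true  = ℤP.+-mono-≤ (f-bound x) -≤+
      ...   | false = ℤP.+-mono-≤ (f-bound x) ℤP.≤-refl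

    swapped-weight : weight swapped ≡ weight f
    swapped-weight rewrite weight-relabel raised w -1ℤ | raised-w | raised-weight = cancel-two (weight f)

    swapped-positiveLeaves : isLeafᵇ G w ≡ false → positiveLeaves G swapped ≡ suc (positiveLeaves G f)
    swapped-positiveLeaves w-inner = trans (count-cong same-off-u) (count-update _ _ u off-u at-u before-u)
      where
      same-off-u : ∀ x → isLeafᵇ G x ∧ isOneᵇ (swapped x) ≡ isLeafᵇ G x ∧ isOneᵇ (raised x)
      same-off-u x with x ≟ w
      ... | yes refl rewrite w-inner = refl
      ... | no x≢w = cong (λ z → isLeafᵇ G x ∧ isOneᵇ z) (relabel-off raised w -1ℤ x≢w)
      off-u : ∀ x → x ≢ u → isLeafᵇ G x ∧ isOneᵇ (raised x) ≡ isLeafᵇ G x ∧ isOneᵇ (f x)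
      off-u x x≢u = cong (λ z → isLeafᵇ G x ∧ isOneᵇ z) (relabel-off f u 1ℤ x≢u)
      at-u : isLeafᵇ G u ∧ isOneᵇ (raised u) ≡ true
      at-u rewrite relabel-at f u 1ℤ | u-leaf = refl
      before-u : isLeafᵇ G u ∧ isOneᵇ (f u) ≡ false
      before-u rewrite u-leaf | fu = refl

negativeLeaves : ∀ {n} → Graph n → (Fin n → ℤ) → Fin n → ℕ
negativeLeaves G f v = count (λ u → adj G v u ∧ isLeafᵇ G u ∧ not (isOneᵇ (f u)))

leafCount-split : ∀ {n} (G : Graph n) (f : Fin n → ℤ) v →
  leafCount G v ≡ posLeafCount G f v ℕ.+ negativeLeaves G f v
leafCount-split G f v = trans (count-split (λ x → adj G v x ∧ isLeafᵇ G x) (λ x → isOneᵇ (f x)))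
  (cong₂ ℕ._+_ (count-cong (λ x → ∧-assoc (adj G v x) (isLeafᵇ G x) (isOneᵇ (f x))))
               (count-cong (λ x → ∧-assoc (adj G v x) (isLeafᵇ G x) (not (isOneᵇ (f x))))))

∧-true : ∀ {a b} → a ∧ b ≡ true → a ≡ true × b ≡ true
∧-true {true} {true} refl = refl , refl

not-true : ∀ {a} → not a ≡ true → a ≡ false
not-true {false} refl = refl

∧-insert : ∀ {a l o} → (a ≡ true → o ≡ true → l ≡ true) → a ∧ o ≡ true → a ∧ (l ∧ o) ≡ true
∧-insert {true} {_} {true} l-holds refl rewrite l-holds refl refl = refl

∧-drop : ∀ {a l o} → a ∧ (l ∧ o) ≡ true → a ∧ o ≡ true
∧-drop {true} {true} a∧l∧o = a∧l∧o

∧-not-intro : ∀ {a b c} → a ≡ true → b ≡ false → c ≡ true → a ∧ not b ∧ c ≡ true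
∧-not-intro refl refl refl = refl

two-below : ∀ N {a b} → N ℤ.+ + b ≡ + a → 2 ℕ.+ a ≤ b → N ℤ.+ + 2 ℤ.≤ 0ℤ
two-below N {a} {b} N+b≡a 2+a≤b = begin
    N ℤ.+ + 2
  ≡⟨ solve 2 (λ N B → N :+ con (+ 2) := (N :+ B) :+ (con (+ 2) :- B)) refl N (+ b) ⟩
    (N ℤ.+ + b) ℤ.+ (+ 2 ℤ.- + b)
  ≡⟨ cong (λ z → z ℤ.+ (+ 2 ℤ.- + b)) N+b≡a ⟩
    + a ℤ.+ (+ 2 ℤ.- + b)
  ≤⟨ ℤP.+-monoʳ-≤ (+ a) (ℤP.+-monoʳ-≤ (+ 2) (ℤP.neg-mono-≤ (+≤+ 2+a≤b))) ⟩
    + a ℤ.+ (+ 2 ℤ.- (+ 2 ℤ.+ + a))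
  ≡⟨ solve 1 (λ A → A :+ (con (+ 2) :- (con (+ 2) :+ A)) := con 0ℤ) refl (+ a) ⟩
    0ℤ ∎
  where open ℤP.≤-Reasoning
        open +-*-Solver using (solve; _:=_; _:+_; _:-_; con)

crowded-nbhd : ∀ {n} (G : Graph n) (f : Fin n → ℤ) → (∀ x → Sign (f x)) → ∀ v →
  (∀ w → adj G v w ≡ true → isOneᵇ (f w) ≡ true → isLeafᵇ G w ≡ true) →
  2 ℕ.+ posLeafCount G f v ≤ negativeLeaves G f v → nbhdSum G f v ℤ.+ + 2 ℤ.≤ 0ℤ
crowded-nbhd G f sf v positive-leaves excess =
  two-below (nbhdSum G f v) (selectedSum (adj G v) f sf)
    (ℕP.≤-trans (ℕP.+-monoʳ-≤ 2 positive≤p) (ℕP.≤-trans excess q≤negative))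
  where
  positive≤p : count (λ x → adj G v x ∧ isOneᵇ (f x)) ≤ posLeafCount G f v
  positive≤p = count-mono (λ x → ∧-insert (positive-leaves x))
  q≤negative : negativeLeaves G f v ≤ count (λ x → adj G v x ∧ not (isOneᵇ (f x)))
  q≤negative = count-mono (λ x → ∧-drop {adj G v x} {isLeafᵇ G x})

no-gain : ∀ i → i ℤ.+ + 2 ℤ.≤ i → ⊥
no-gain i i+2≤i = ℤP.<⇒≱ (subst (ℤ._< i ℤ.+ + 2) (ℤP.+-identityʳ i) (ℤP.+-monoʳ-< i (ℤ.+<+ (s≤s z≤n)))) i+2≤i

module Balance {n} (G : Graph n) (f : Fin n → ℤ) (optimal : Optimal G f) (v : Fin n) where

  isf : IsISTDF G f
  isf = proj₁ (proj₁ optimal)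

  p q : ℕ
  p = posLeafCount G f v
  q = negativeLeaves G f v

  negative-leaf-neighbour : 1 ≤ q → ∃ λ u → adj G v u ≡ true × isLeafᵇ G u ≡ true × f u ≡ -1ℤ
  negative-leaf-neighbour q≥1 with count-witness (λ x → adj G v x ∧ isLeafᵇ G x ∧ not (isOneᵇ (f x))) q≥1
  ... | u , u-ok with ∧-true u-ok
  ...   | v~u , u-ok′ with ∧-true u-ok′
  ...     | u-leaf , u-neg = u , v~u , u-leaf , sign-minus (proj₁ isf u) (not-true u-neg)

  positive-neighbours :
    (∃ λ w → adj G v w ≡ true × isLeafᵇ G w ≡ false × f w ≡ 1ℤ) ⊎
    (∀ w → adj G v w ≡ true → isOneᵇ (f w) ≡ true → isLeafᵇ G w ≡ true)
  positive-neighbours with any? (λ w → (adj G v w ∧ not (isLeafᵇ G w) ∧ isOneᵇ (f w)) Bool.≟ true)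
  ... | yes (w , w-ok) with ∧-true w-ok
  ...   | v~w , w-ok′ with ∧-true w-ok′
  ...     | w-inner , w-pos = inj₁ (w , v~w , not-true w-inner , sign-one (proj₁ isf w) w-pos)
  positive-neighbours | no none = inj₂ all-leaves
    where
    all-leaves : ∀ w → adj G v w ≡ true → isOneᵇ (f w) ≡ true → isLeafᵇ G w ≡ true
    all-leaves w v~w w-pos with isLeafᵇ G w in w-leaf?
    ... | true  = refl
    ... | false = ⊥-elim (none (w , ∧-not-intro v~w w-leaf? w-pos))

  -- Swapping a negative leaf with a positive inner neighbour of v would gain a positive leaf.
  swap-impossible : ∀ {u w} → adj G v u ≡ true → isLeafᵇ G u ≡ true → f u ≡ -1ℤ →
    adj G v w ≡ true → isLeafᵇ G w ≡ false → f w ≡ 1ℤ → ⊥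
  swap-impossible v~u u-leaf fu v~w w-inner fw =
    ℕP.1+n≰n (subst (_≤ positiveLeaves G f) (swapped-positiveLeaves w-inner)
      (proj₂ optimal swapped swapped-ISTDF swapped-weight))
    where open LeafMove G f isf u-leaf v~u fu
          open Swap v~w fw

  -- Raising a negative leaf when f(N(v)) ≤ −2 would increase the weight.
  raise-impossible : ∀ {u} → adj G v u ≡ true → isLeafᵇ G u ≡ true → f u ≡ -1ℤ →
    nbhdSum G f v ℤ.+ + 2 ℤ.≤ 0ℤ → ⊥
  raise-impossible v~u u-leaf fu slack =
    no-gain (weight f) (subst (ℤ._≤ weight f) raised-weight (proj₂ (proj₁ optimal) raised (raised-ISTDF slack)))
    where open LeafMove G f isf u-leaf v~u fu

  -- Either move refutes q ≥ p + 2.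
  excess-impossible : 2 ℕ.+ p ≤ q → ⊥
  excess-impossible excess with negative-leaf-neighbour (ℕP.≤-trans (s≤s z≤n) excess) | positive-neighbours
  ... | u , v~u , u-leaf , fu | inj₁ (w , v~w , w-inner , fw) = swap-impossible v~u u-leaf fu v~w w-inner fw
  ... | u , v~u , u-leaf , fu | inj₂ all-leaves =
    raise-impossible v~u u-leaf fu (crowded-nbhd G f (proj₁ isf) v all-leaves excess)

  balanced : q ≤ suc p
  balanced with q ℕ.≤? suc p
  ... | yes q≤1+p = q≤1+p
  ... | no  q≰1+p = ⊥-elim (excess-impossible (ℕP.≰⇒> q≰1+p))

half-bound : ∀ p q → q ≤ suc p → (p ℕ.+ q) / 2 ≤ p
half-bound p q q≤1+p = ℕP.≤-pred (ℕP.*-cancelʳ-< 2 ((p ℕ.+ q) / 2) (suc p) (begin-strict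
    (p ℕ.+ q) / 2 ℕ.* 2  ≤⟨ m/n*n≤m (p ℕ.+ q) 2 ⟩
    p ℕ.+ q              ≤⟨ ℕP.+-monoʳ-≤ p q≤1+p ⟩
    p ℕ.+ suc p          <⟨ ℕP.n<1+n _ ⟩
    suc (p ℕ.+ suc p)    ≡⟨ solve 1 (λ p → con 1 :+ (p :+ (con 1 :+ p)) := (con 1 :+ p) :* con 2) refl p ⟩
    suc p ℕ.* 2          ∎))
  where open ℕP.≤-Reasoning
        open Data.Nat.Solver.+-*-Solver using (solve; _:=_; _:+_; _:*_; con)

optimal-leaf-bound : ∀ {n} (G : Graph n) (f : Fin n → ℤ) → Optimal G f →
  ∀ v → leafCount G v / 2 ≤ posLeafCount G f v
optimal-leaf-bound G f optimal v =
  subst (λ ℓ → ℓ / 2 ≤ posLeafCount G f v) (sym (leafCount-split G f v))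
    (half-bound (posLeafCount G f v) (negativeLeaves G f v) (Balance.balanced G f optimal v))

signFunctions : ∀ n → List (Fin n → ℤ)
signFunctions zero    = Vector.[] ∷ []
signFunctions (suc n) = map (1ℤ Vector.∷_) (signFunctions n) ++ map (-1ℤ Vector.∷_) (signFunctions n)

signFunctions-complete : ∀ {n} (g : Fin n → ℤ) → (∀ x → Sign (g x)) →
  ∃ λ h → h ∈ signFunctions n × g ≗ h
signFunctions-complete {zero} g _ = Vector.[] , here refl , λ ()
signFunctions-complete {suc n} g sg with signFunctions-complete (g ∘ suc) (sg ∘ suc) | sg zero
... | h , h∈ , g≗h | inj₁ g₀≡1 =
  1ℤ Vector.∷ h , ∈-++⁺ˡ (∈-map⁺ (1ℤ Vector.∷_) h∈) , λ { zero → g₀≡1 ; (suc i) → g≗h i }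
... | h , h∈ , g≗h | inj₂ g₀≡-1 =
  -1ℤ Vector.∷ h , ∈-++⁺ʳ (map (1ℤ Vector.∷_) (signFunctions n)) (∈-map⁺ (-1ℤ Vector.∷_) h∈) ,
  λ { zero → g₀≡-1 ; (suc i) → g≗h i }

maximise : ∀ {n} (P : (Fin n → ℤ) → Set) → Decidable P →
  (∀ {g h} → g ≗ h → P g → P h) → (∀ {g} → P g → ∀ x → Sign (g x)) →
  (score : (Fin n → ℤ) → ℤ) → (∀ {g h} → g ≗ h → score g ≡ score h) →
  ∀ g₀ → P g₀ → Σ (Fin n → ℤ) λ f → P f × (∀ g → P g → score g ℤ.≤ score f)
maximise {n} P P? P-ext P-sign score score-ext g₀ Pg₀ = best , P-best , best-bound
  where
  candidates : List (Fin n → ℤ)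
  candidates = filter P? (signFunctions n)
  best : Fin n → ℤ
  best = argmax score g₀ candidates
  P-best : P best
  P-best = argmax-all score Pg₀ (all-filter P? (signFunctions n))
  best-bound : ∀ g → P g → score g ℤ.≤ score best
  best-bound g Pg with signFunctions-complete g (P-sign Pg)
  ... | h , h∈ , g≗h = subst (ℤ._≤ score best) (sym (score-ext g≗h))
    (lookup (f[xs]≤f[argmax] {f = score} g₀ candidates) (∈-filter⁺ P? h∈ (P-ext g≗h Pg)))

maximum-exists : ∀ {n} (G : Graph n) → Σ (Fin n → ℤ) (IsMaxISTDF G)
maximum-exists G =
  maximise (IsISTDF G) (isISTDF? G) (ISTDF-ext G) proj₁ weight sumℤ-cong (const -1ℤ) (minus-ISTDF G)

optimal-exists : ∀ {n} (G : Graph n) → Σ (Fin n → ℤ) (Optimal G)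
optimal-exists {n} G with maximum-exists G
... | f₁ , isf₁ , maxW₁ with maximise MaxWeight maxWeight? maxWeight-ext (proj₁ ∘ proj₁)
                               (λ g → + positiveLeaves G g) (cong +_ ∘ count-cong ∘ leaf-cong) f₁ (isf₁ , refl)
  where
  MaxWeight : (Fin n → ℤ) → Set
  MaxWeight g = IsISTDF G g × weight g ≡ weight f₁
  maxWeight? : Decidable MaxWeight
  maxWeight? g = isISTDF? G g ×-dec (weight g ℤ.≟ weight f₁)
  maxWeight-ext : ∀ {g h} → g ≗ h → MaxWeight g → MaxWeight h
  maxWeight-ext g≗h (isg , wg) = ISTDF-ext G g≗h isg , trans (sym (sumℤ-cong g≗h)) wg
  leaf-cong : ∀ {g h : Fin n → ℤ} → g ≗ h → ∀ x → isLeafᵇ G x ∧ isOneᵇ (g x) ≡ isLeafᵇ G x ∧ isOneᵇ (h x)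
  leaf-cong g≗h x = cong (λ z → isLeafᵇ G x ∧ isOneᵇ z) (g≗h x)
... | f , (isf , wf) , maxP =
  f , (isf , λ g isg → subst (weight g ℤ.≤_) (sym wf) (maxW₁ g isg)) ,
      λ g isg wg → ℤP.drop‿+≤+ (maxP g (isg , trans wg wf))

mainTheorem6 : ∀ (n : ℕ) (T : Graph n) → IsTree T →
    Σ (Fin n → ℤ) (λ f → IsMaxISTDF T f ×
      (∀ (v : Fin n) → IsSupport T v → leafCount T v / 2 ≤ posLeafCount T f v))
mainTheorem6 n T _ with optimal-exists T
... | f , optimal = f , proj₁ optimal , λ v _ → optimal-leaf-bound T f optimal v
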